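{- For any connected graph $G$ of order at least $2$, $Z(G) \le 2 Z(L(G))$.
   Context: All graphs are finite, simple and undirected. $L(G)$ is the line graph of $G$. Zero forcing: each vertex of a graph $H$ is colored black or white; if a black vertex $u$ has exactly one white neighbor $w$, then $w$ becomes black (color-change rule). $S \subseteq V(H)$ is a zero forcing set if, starting with exactly $S$ black, repeated application of the rule makes every vertex black. $Z(H)$ is the minimum size of a zero forcing set of $H$. -}

module Defs where

open import Data.Nat using (ℕ; _≤_; _*_)
open import Data.Fin using (Fin; _<_)
open import Data.Bool using (Bool; true; false)
open import Data.Product using (Σ; _×_; _,_; ∃; proj₁)
open import Data.Sum using (_⊎_)
open import Data.List using (List; length)
open import Data.List.Membership.Propositional using (_∈_)
open import Data.List.Relation.Unary.Unique.Propositional using (Unique)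
open import Relation.Binary.PropositionalEquality using (_≡_; _≢_; trans; sym)
open import Relation.Nullary using (¬_)

-- A general simple undirected graph on an arbitrary vertex type.
-- Used as the common interface for zero forcing on G and on L(G).

record Graph : Set₁ where
  field
    V       : Set
    Adj     : V → V → Set
    Adj-sym : ∀ {u v} → Adj u v → Adj v u
    Adj-irr : ∀ {v} → ¬ Adj v v
open Graph public

record SimpleGraph (n : ℕ) : Set where
  field
    adj     : Fin n → Fin n → Bool
    adj-sym : ∀ i j → adj i j ≡ adj j i
    adj-irr : ∀ i → adj i i ≡ false
open SimpleGraph public

private
  irr-lemma : ∀ {n} (G : SimpleGraph n) v → ¬ (adj G v v ≡ true)
  irr-lemma G v e with trans (sym (adj-irr G v)) e
  ... | ()

toGraph : ∀ {n} → SimpleGraph n → Graph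
toGraph {n} G = record
  { V       = Fin n
  ; Adj     = λ i j → adj G i j ≡ true
  ; Adj-sym = λ {u} {v} e → trans (adj-sym G v u) e
  ; Adj-irr = λ {v} → irr-lemma G v
  }

data Walk {n} (G : SimpleGraph n) : Fin n → Fin n → Set where
  here : ∀ {u} → Walk G u u
  step : ∀ {u v w} → adj G u v ≡ true → Walk G v w → Walk G u w

Connected : ∀ {n} → SimpleGraph n → Set
Connected {n} G = ∀ (u v : Fin n) → Walk G u v

Edge : ∀ {n} → SimpleGraph n → Set
Edge {n} G = Σ (Fin n × Fin n) λ p → (proj₁ p < Data.Product.proj₂ p) × (adj G (proj₁ p) (Data.Product.proj₂ p) ≡ true)

endpoints : ∀ {n} {G : SimpleGraph n} → Edge G → Fin n × Fin n
endpoints (p , _) = p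

ShareEnd : ∀ {n} → Fin n × Fin n → Fin n × Fin n → Set
ShareEnd (i , j) (k , l) = (i ≡ k) ⊎ (i ≡ l) ⊎ (j ≡ k) ⊎ (j ≡ l)

LAdj : ∀ {n} (G : SimpleGraph n) → Edge G → Edge G → Set
LAdj G e f = (endpoints {G = G} e ≢ endpoints {G = G} f) × ShareEnd (endpoints {G = G} e) (endpoints {G = G} f)

private
  share-sym : ∀ {n} (p q : Fin n × Fin n) → ShareEnd p q → ShareEnd q p
  share-sym (i , j) (k , l) (Data.Sum.inj₁ e) = Data.Sum.inj₁ (sym e)
  share-sym (i , j) (k , l) (Data.Sum.inj₂ (Data.Sum.inj₁ e)) = Data.Sum.inj₂ (Data.Sum.inj₂ (Data.Sum.inj₁ (sym e)))
  share-sym (i , j) (k , l) (Data.Sum.inj₂ (Data.Sum.inj₂ (Data.Sum.inj₁ e))) = Data.Sum.inj₂ (Data.Sum.inj₁ (sym e))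
  share-sym (i , j) (k , l) (Data.Sum.inj₂ (Data.Sum.inj₂ (Data.Sum.inj₂ e))) = Data.Sum.inj₂ (Data.Sum.inj₂ (Data.Sum.inj₂ (sym e)))

LineGraph : ∀ {n} → SimpleGraph n → Graph
LineGraph G = record
  { V       = Edge G
  ; Adj     = LAdj G
  ; Adj-sym = λ {e} {f} a → (λ eq → Data.Product.proj₁ a (sym eq)) , share-sym (endpoints {G = G} e) (endpoints {G = G} f) (Data.Product.proj₂ a)
  ; Adj-irr = λ a → Data.Product.proj₁ a Relation.Binary.PropositionalEquality.refl
  }

-- Forced H S v : v is black at the end of the forcing process started from
-- exactly the vertices in S black.  The final colouring is the closure of S
-- under the colour-change rule: w becomes black if some black u is adjacent
-- to w and every neighbour of u other than w is black.

data Forced (H : Graph) (S : List (V H)) : V H → Set where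
  initial : ∀ {v} → v ∈ S → Forced H S v
  force   : ∀ {u w} → Forced H S u → Adj H u w →
            (∀ x → Adj H u x → x ≢ w → Forced H S x) →
            Forced H S w

-- S (a duplicate-free list of vertices, i.e. a finite set) is a zero forcing set.
IsZeroForcingSet : (H : Graph) → List (V H) → Set
IsZeroForcingSet H S = ∀ v → Forced H S v

IsZ : (H : Graph) → ℕ → Set
IsZ H k =
  (Σ (List (V H)) λ S → Unique S × IsZeroForcingSet H S × length S ≡ k)
  × (∀ (S : List (V H)) → Unique S → IsZeroForcingSet H S → k ≤ length S)

-- Let S′ be a zero forcing set of L(G) and S the set of endpoints of its edges, so |S| ≤ 2|S′|.
-- By induction on forcing in L(G), both ends of every forced edge are forced from S in G:
-- if the edge cv forces cw, then every neighbour x ≠ w of c is either v or the far end of an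
-- edge cx different from cv and cw, which was black when cv forced, so c forces w in G.
-- Since G is connected with at least two vertices, every vertex lies on an edge.
module Submission where

open import Defs
open import Data.Nat using (ℕ; _≤_; _*_; _+_; s≤s)
open import Data.Nat.Properties using (*-suc; ≤-trans; module ≤-Reasoning)
open import Data.Fin using (Fin; _≟_) renaming (zero to fzero; suc to fsuc)
open import Data.Fin.Properties using (<-cmp; <-irrefl)
open import Data.Bool using (true)
open import Data.Empty using (⊥-elim)
open import Data.Product using (Σ; ∃-syntax; _×_; _,_; proj₁; proj₂)
open import Data.Sum using (_⊎_; inj₁; inj₂)
open import Data.List using (List; []; _∷_; length; deduplicate)
open import Data.List.Properties using (length-deduplicate)
open import Data.List.Membership.Propositional using (_∈_)
open import Data.List.Membership.Propositional.Properties using (∈-deduplicate⁺)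
open import Data.List.Relation.Binary.Subset.Propositional using (_⊆_)
open import Data.List.Relation.Unary.Any using (here; there)
open import Data.List.Relation.Unary.Unique.DecPropositional.Properties using (deduplicate-!)
open import Relation.Binary.Definitions using (DecidableEquality; tri<; tri≈; tri>)
open import Relation.Binary.PropositionalEquality using (_≡_; _≢_; refl; sym; trans; cong)
open import Relation.Nullary using (yes; no)

Forced-mono : ∀ {H : Graph} {S T : List (V H)} → S ⊆ T → ∀ {v} → Forced H S v → Forced H T v
Forced-mono S⊆T (initial v∈S)    = initial (S⊆T v∈S)
Forced-mono S⊆T (force Fu uw rest) =
  force (Forced-mono S⊆T Fu) uw (λ x ux x≢w → Forced-mono S⊆T (rest x ux x≢w))

IsZ-≤-length : ∀ {H : Graph} → DecidableEquality (V H) → ∀ {k} {S : List (V H)} →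
               IsZ H k → IsZeroForcingSet H S → k ≤ length S
IsZ-≤-length _≟ᵥ_ {S = S} (_ , minimal) zfs =
  ≤-trans (minimal (deduplicate _≟ᵥ_ S) (deduplicate-! _≟ᵥ_ S)
                   (λ v → Forced-mono (∈-deduplicate⁺ _≟ᵥ_) (zfs v)))
          (length-deduplicate _≟ᵥ_ S)

module _ {n : ℕ} (G : SimpleGraph n) where

  private
    E = Edge G
    ends : E → Fin n × Fin n
    ends = endpoints {G = G}

  -- Unlike endpoints, Joins e c x forgets the orientation i < j of the stored pair.
  Joins : E → Fin n → Fin n → Set
  Joins e c x = ends e ≡ (c , x) ⊎ ends e ≡ (x , c)

  BothEnds : (Fin n → Set) → E → Set
  BothEnds P e = P (proj₁ (ends e)) × P (proj₂ (ends e))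

  edge-joining : ∀ {c x} → adj G c x ≡ true → Σ E λ g → Joins g c x
  edge-joining {c} {x} cx with <-cmp c x
  ... | tri< c<x _ _ = ((c , x) , c<x , cx) , inj₁ refl
  ... | tri≈ _ refl _ with trans (sym (adj-irr G c)) cx
  ...   | ()
  edge-joining {c} {x} cx | tri> _ _ x<c = ((x , c) , x<c , trans (adj-sym G x c) cx) , inj₂ refl

  Joins⇒adj : ∀ e {c x} → Joins e c x → adj G c x ≡ true
  Joins⇒adj ((c , x) , _ , cx) (inj₁ refl) = cx
  Joins⇒adj ((x , c) , _ , xc) (inj₂ refl) = trans (adj-sym G c x) xc

  BothEnds⇒ : ∀ {P} e {c x} → Joins e c x → BothEnds P e → P c × P x
  BothEnds⇒ e (inj₁ refl) (Pc , Px) = Pc , Px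
  BothEnds⇒ e (inj₂ refl) (Px , Pc) = Pc , Px

  ⇒BothEnds : ∀ {P} e {c x} → Joins e c x → P c → P x → BothEnds P e
  ⇒BothEnds e (inj₁ refl) Pc Px = Pc , Px
  ⇒BothEnds e (inj₂ refl) Pc Px = Px , Pc

  Joins-far-end : ∀ e g {c x y} → Joins e c x → Joins g c y → ends e ≡ ends g → x ≡ y
  Joins-far-end (_ , c<x , _) _ (inj₁ refl) (inj₁ refl) refl = refl
  Joins-far-end (_ , c<x , _) _ (inj₁ refl) (inj₂ refl) refl = ⊥-elim (<-irrefl refl c<x)
  Joins-far-end (_ , x<c , _) _ (inj₂ refl) (inj₁ refl) refl = ⊥-elim (<-irrefl refl x<c)
  Joins-far-end (_ , x<c , _) _ (inj₂ refl) (inj₂ refl) refl = refl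

  Joins⇒ShareEnd : ∀ e g {c x y} → Joins e c x → Joins g c y → ShareEnd (ends e) (ends g)
  Joins⇒ShareEnd _ _ (inj₁ refl) (inj₁ refl) = inj₁ refl
  Joins⇒ShareEnd _ _ (inj₁ refl) (inj₂ refl) = inj₂ (inj₁ refl)
  Joins⇒ShareEnd _ _ (inj₂ refl) (inj₁ refl) = inj₂ (inj₂ (inj₁ refl))
  Joins⇒ShareEnd _ _ (inj₂ refl) (inj₂ refl) = inj₂ (inj₂ (inj₂ refl))

  ShareEnd⇒Joins : ∀ e f → ShareEnd (ends e) (ends f) → ∃[ c ] ∃[ v ] ∃[ w ] Joins e c v × Joins f c w
  ShareEnd⇒Joins ((i , j) , _) ((_ , l) , _) (inj₁ refl)               = i , j , l , inj₁ refl , inj₁ refl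
  ShareEnd⇒Joins ((i , j) , _) ((k , _) , _) (inj₂ (inj₁ refl))        = i , j , k , inj₁ refl , inj₂ refl
  ShareEnd⇒Joins ((i , j) , _) ((_ , l) , _) (inj₂ (inj₂ (inj₁ refl))) = j , i , l , inj₂ refl , inj₁ refl
  ShareEnd⇒Joins ((i , j) , _) ((k , _) , _) (inj₂ (inj₂ (inj₂ refl))) = j , i , k , inj₂ refl , inj₂ refl

  endpointList : List E → List (Fin n)
  endpointList []       = []
  endpointList (e ∷ es) = proj₁ (ends e) ∷ proj₂ (ends e) ∷ endpointList es

  length-endpointList : ∀ es → length (endpointList es) ≡ 2 * length es
  length-endpointList []       = refl
  length-endpointList (e ∷ es) =
    trans (cong (2 +_) (length-endpointList es)) (sym (*-suc 2 (length es)))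

  ∈-endpointList : ∀ {e es} → e ∈ es → BothEnds (_∈ endpointList es) e
  ∈-endpointList (here refl) = here refl , there (here refl)
  ∈-endpointList (there e∈es) with ∈-endpointList e∈es
  ... | i∈ , j∈ = there (there i∈) , there (there j∈)

  module _ (S′ : List E) where

    private
      Black : Fin n → Set
      Black = Forced (toGraph G) (endpointList S′)

    forced-edge⇒forced-ends : ∀ {e} → Forced (LineGraph G) S′ e → BothEnds Black e
    forced-edge⇒forced-ends (initial e∈S′) with ∈-endpointList e∈S′
    ... | i∈ , j∈ = initial i∈ , initial j∈
    forced-edge⇒forced-ends {f} (force {e} Fe (_ , e∩f) others) with ShareEnd⇒Joins e f e∩f
    ... | c , v , w , e=cv , f=cw = ⇒BothEnds f f=cw black-c black-w
      where
      black-c,v : Black c × Black v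
      black-c,v = BothEnds⇒ e e=cv (forced-edge⇒forced-ends Fe)

      black-c : Black c
      black-c = proj₁ black-c,v

      other-neighbours : ∀ x → adj G c x ≡ true → x ≢ w → Black x
      other-neighbours x cx x≢w with x ≟ v
      ... | yes refl = proj₂ black-c,v
      ... | no x≢v with edge-joining cx
      ...   | g , g=cx = proj₂ (BothEnds⇒ g g=cx (forced-edge⇒forced-ends (others g e~g g≢f)))
        where
        e~g : LAdj G e g
        e~g = (λ eq → x≢v (sym (Joins-far-end e g e=cv g=cx eq))) , Joins⇒ShareEnd e g e=cv g=cx
        g≢f : g ≢ f
        g≢f refl = x≢w (Joins-far-end g f g=cx f=cw refl)

      black-w : Black w
      black-w = force black-c (Joins⇒adj f f=cw) other-neighbours

  has-neighbour : Connected G → 2 ≤ n → ∀ v → ∃[ w ] adj G v w ≡ true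
  has-neighbour connected (s≤s (s≤s _)) v = first-step v (other v) (other≢ v) (connected v (other v))
    where
    other : Fin n → Fin n
    other fzero    = fsuc fzero
    other (fsuc _) = fzero

    other≢ : ∀ u → u ≢ other u
    other≢ fzero    ()
    other≢ (fsuc _) ()

    first-step : ∀ v u → v ≢ u → Walk G v u → ∃[ w ] adj G v w ≡ true
    first-step v .v v≢v here      = ⊥-elim (v≢v refl)
    first-step v u  _   (step vw _) = _ , vw

  endpoints-zero-forcing : Connected G → 2 ≤ n → ∀ S′ →
    IsZeroForcingSet (LineGraph G) S′ → IsZeroForcingSet (toGraph G) (endpointList S′)
  endpoints-zero-forcing connected n≥2 S′ zfs v with has-neighbour connected n≥2 v
  ... | _ , vw with edge-joining vw
  ...   | g , g=vw = proj₁ (BothEnds⇒ g g=vw (forced-edge⇒forced-ends S′ (zfs g)))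

theorem3p11 : ∀ (n : ℕ) (G : SimpleGraph n) → Connected G → 2 ≤ n →
    ∀ (a b : ℕ) → IsZ (toGraph G) a → IsZ (LineGraph G) b → a ≤ 2 * b
theorem3p11 n G connected n≥2 a b Za ((S′ , _ , zfs , refl) , _) = begin
  a                           ≤⟨ IsZ-≤-length _≟_ Za (endpoints-zero-forcing G connected n≥2 S′ zfs) ⟩
  length (endpointList G S′)  ≡⟨ length-endpointList G S′ ⟩
  2 * length S′               ∎
  where open ≤-Reasoning
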